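{- Let $t$ be a positive integer. Then for every non-negative integer $n$, $$p_{t,t}(n)= p(n)+\sum_{r=1}^{\infty}p\big(n-tr(2r+1)\big)-\sum_{s=1}^{\infty}p\big(n-ts(2s-1)\big)$$ and $$p_{2t,t}(n)= p(n)+\sum_{r=1}^{\infty}p(n-4tr^2)-\sum_{s=1}^{\infty}p\big(n-t(2s-1)^2\big).$$
   Context: $p(n)$ denotes the number of partitions of $n$, with the convention $p(n)=0$ for negative integers $n$ (so the sums are finite). For a partition $\lambda$ and positive integers $A,a$, $\mathrm{mex}_{A,a}(\lambda)$ is the smallest positive integer congruent to $a$ modulo $A$ that is not a part of $\lambda$. For $n\ge 0$, $p_{A,a}(n)$ is the number of partitions $\lambda$ of $n$ with $\mathrm{mex}_{A,a}(\lambda)\equiv a \pmod{2A}$. -}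

module Defs where

open import Data.Nat using (ℕ; zero; suc; _+_; _*_; _∸_; _≤ᵇ_; _≡ᵇ_; _%_)
open import Data.Nat.Properties using ()
open import Data.Bool using (Bool; true; false; if_then_else_)
open import Data.List using (List; []; _∷_; _++_; map; length; filter; sum)
open import Data.Bool.ListAction using (any)
open import Data.Integer using (ℤ; +_)
open import Relation.Nullary.Decidable using (yes; no)
open import Data.Bool using (T)
open import Data.Bool.Properties using (T?)

-- Partitions of n are represented as non-increasing lists of positive
-- integers summing to n.  `partitionsBounded fuel n k` lists every
-- partition of n all of whose parts are ≤ k, each exactly once
-- (enumerated by first choosing how many times / whether the largest
-- allowed part k is used).  The fuel only ensures termination; each
-- recursive call decreases n + k, so fuel = n + k + 1 suffices.

partitionsBounded : ℕ → ℕ → ℕ → List (List ℕ)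
partitionsBounded zero    _       _       = []
partitionsBounded (suc f) zero    _       = [] ∷ []
partitionsBounded (suc f) (suc n) zero    = []
partitionsBounded (suc f) (suc n) (suc k) =
  partitionsBounded f (suc n) k
  ++ (if suc k ≤ᵇ suc n
        then map (suc k ∷_) (partitionsBounded f (suc n ∸ suc k) (suc k))
        else [])

partitions : ℕ → List (List ℕ)
partitions n = partitionsBounded (suc (n + n)) n n

p : ℕ → ℕ
p n = length (partitions n)

pℤ : ℤ → ℕ
pℤ (+ n) = p n
pℤ _     = 0

-- mex_{A,a}(λ): the smallest positive integer ≡ a (mod A) that is not a
-- part of λ.  The candidates are m₀, m₀ + A, m₀ + 2A, … where
-- m₀ = ((a - 1) mod A) + 1 is the smallest positive integer ≡ a (mod A).
-- Since λ has only `length λ` parts, at most `length λ + 1` candidates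
-- need to be tried (this is the fuel).

isPart : ℕ → List ℕ → Bool
isPart m λ' = any (λ x → x ≡ᵇ m) λ'

mexSearch : ℕ → ℕ → ℕ → List ℕ → ℕ
mexSearch zero    A m λ' = m
mexSearch (suc f) A m λ' = if isPart m λ' then mexSearch f A (m + A) λ' else m

-- A is required to be positive; for A = 0 the value is junk (0).
mex : ℕ → ℕ → List ℕ → ℕ
mex zero    a λ' = 0
mex (suc B) a λ' = mexSearch (suc (length λ')) (suc B) (suc ((a ∸ 1) % suc B)) λ'

pA : ℕ → ℕ → ℕ → ℕ
pA zero    a n = 0
pA (suc B) a n =
  length (filter (λ λ' → T? (mex (suc B) a λ' % (2 * suc B) ≡ᵇ a % (2 * suc B)))
                 (partitions n))

Σ₁ : ℕ → (ℕ → ℕ) → ℕ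
Σ₁ zero    f = 0
Σ₁ (suc N) f = Σ₁ N f + f (suc N)

{-# OPTIONS --safe #-}
-- For a partition λ, let k be the number of initial terms a, a + A, …, a + (k − 1)A of the
-- progression that are parts of λ, so that mex_{A,a}(λ) = a + kA; for 0 < a ≤ A this is
-- ≡ a (mod 2A) exactly when k is even.  Since [k even] = Σ_j (−1)^j [j ≤ k], summing over the
-- partitions of n gives p_{A,a}(n) = Σ_j (−1)^j c_j, where c_j counts the partitions of n that
-- contain the j distinct parts a, a + A, …, a + (j − 1)A.  Removing these parts shows
-- c_j = p(n − σ_j) with σ_j = ja + A j(j − 1)/2, and for (A, a) = (t, t) and (2t, t) the values
-- σ_{2r}, σ_{2s−1} are t r(2r + 1), t s(2s − 1) and 4t r², t(2s − 1)².
module Submission where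

open import Defs
open import Data.Bool using (Bool; true; false; if_then_else_; _∧_; _∨_)
open import Data.Bool.Properties using (∧-zeroʳ)
open import Data.Empty using (⊥; ⊥-elim)
open import Data.Integer as ℤ using (ℤ; +_; -[1+_]; _⊖_)
import Data.Integer.Properties as ℤₚ
import Data.Integer.Tactic.RingSolver as ℤ-Solver
open import Data.List using (List; []; _∷_; _++_; map; length; filter)
open import Data.List.Properties using (length-++; length-map; ++-identityʳ; filter-++)
open import Data.List.Relation.Unary.All as All using (All; []; _∷_)
open import Data.List.Relation.Unary.All.Properties using (++⁺; map⁺)
open import Data.Nat
open import Data.Nat.DivMod using ([m+kn]%n≡m%n; m<n⇒m%n≡m; n%n≡0)
open import Data.Nat.ListAction using (sum)
open import Data.Nat.Properties
open import Data.Nat.Tactic.RingSolver using (solve-∀)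
open import Data.Product using (_×_; _,_; ∃-syntax)
open import Data.Sum using (_⊎_; inj₁; inj₂)
open import Data.Unit using (⊤; tt)
open import Function using (_∘_; _⇔_; mk⇔)
open import Relation.Nullary.Decidable using (yes; no; T?; dec-true; dec-false; does-⇔)
open import Relation.Binary.PropositionalEquality
open ≡-Reasoning

𝟙 : Bool → ℕ
𝟙 true  = 1
𝟙 false = 0

count : {A : Set} → (A → Bool) → List A → ℕ
count b xs = length (filter (λ x → T? (b x)) xs)

module _ {A : Set} where

  count-∷ : ∀ (b : A → Bool) x xs → count b (x ∷ xs) ≡ 𝟙 (b x) + count b xs
  count-∷ b x xs with b x
  ... | true  = refl
  ... | false = refl

  count-++ : ∀ (b : A → Bool) xs ys → count b (xs ++ ys) ≡ count b xs + count b ys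
  count-++ b xs ys = trans (cong length (filter-++ (λ x → T? (b x)) xs ys)) (length-++ (filter _ xs))

  count-map : ∀ {B : Set} (b : A → Bool) (f : B → A) xs → count b (map f xs) ≡ count (b ∘ f) xs
  count-map b f []       = refl
  count-map b f (x ∷ xs) with b (f x)
  ... | true  = cong suc (count-map b f xs)
  ... | false = count-map b f xs

  count-cong : ∀ {b c : A → Bool} → (∀ x → b x ≡ c x) → ∀ xs → count b xs ≡ count c xs
  count-cong         e []       = refl
  count-cong {b} {c} e (x ∷ xs) with b x | c x | e x
  ... | true  | true  | refl = cong suc (count-cong e xs)
  ... | false | false | refl = count-cong e xs

  count-none : ∀ {b : A → Bool} {xs} → All (λ x → b x ≡ false) xs → count b xs ≡ 0
  count-none             []       = refl
  count-none {b} {x ∷ _} (e ∷ es) with b x | e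
  ... | false | refl = count-none es

  count-true : ∀ (xs : List A) → count (λ _ → true) xs ≡ length xs
  count-true []       = refl
  count-true (x ∷ xs) = cong suc (count-true xs)

-- Partitions with bounded parts

partitionsBounded-fuel : ∀ {f g} n k → n + k < f → n + k < g →
                         partitionsBounded f n k ≡ partitionsBounded g n k
partitionsBounded-fuel {suc f} {suc g} zero    k       _ _ = refl
partitionsBounded-fuel {suc f} {suc g} (suc n) zero    _ _ = refl
partitionsBounded-fuel {suc f} {suc g} (suc n) (suc k) (s≤s n+k<f) (s≤s n+k<g) =
  cong₂ _++_
    (partitionsBounded-fuel (suc n) k (drop-part n+k<f) (drop-part n+k<g))
    (cong (λ ps → if suc k ≤ᵇ suc n then map (suc k ∷_) ps else [])
      (partitionsBounded-fuel (n ∸ k) (suc k) (≤-trans rest n+k<f) (≤-trans rest n+k<g)))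
  where
  drop-part : ∀ {h} → suc n + suc k ≤ h → suc n + k < h
  drop-part = ≤-trans (s≤s (≤-reflexive (sym (+-suc n k))))
  rest : suc (n ∸ k + suc k) ≤ suc n + suc k
  rest = s≤s (+-monoˡ-≤ (suc k) (m∸n≤m n k))

-- Partitions of z with parts ≤ k; empty for z < 0, so that partitions≤-suc holds for every z.
partitions≤ : ℤ → ℕ → List (List ℕ)
partitions≤ (+ n)    k = partitionsBounded (suc (n + k)) n k
partitions≤ -[1+ _ ] _ = []

partitions≤-⊖ : ∀ {m n} k → m < n → partitions≤ (m ⊖ n) k ≡ []
partitions≤-⊖ {zero}  {suc n} k _         = refl
partitions≤-⊖ {suc m} {suc n} k (s≤s m<n) =
  trans (cong (λ z → partitions≤ z k) (ℤₚ.[1+m]⊖[1+n]≡m⊖n m n)) (partitions≤-⊖ k m<n)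

partitions≤-suc : ∀ z k → partitions≤ z (suc k)
                  ≡ partitions≤ z k ++ map (suc k ∷_) (partitions≤ (z ℤ.- + suc k) (suc k))
partitions≤-suc -[1+ _ ] k = refl
partitions≤-suc (+ zero)  k = refl
partitions≤-suc (+ suc n) k =
  cong₂ _++_ (cong (λ f → partitionsBounded (suc f) (suc n) k) (+-suc n k)) with-largest
  where
  with-largest : (if suc k ≤ᵇ suc n
                   then map (suc k ∷_) (partitionsBounded (suc n + suc k) (n ∸ k) (suc k))
                   else [])
                 ≡ map (suc k ∷_) (partitions≤ (suc n ⊖ suc k) (suc k))
  with-largest with k ≤? n
  ... | yes k≤n rewrite dec-true (suc k ≤? suc n) (s≤s k≤n) | ℤₚ.⊖-≥ (s≤s k≤n) =
    cong (map (suc k ∷_)) (partitionsBounded-fuel (n ∸ k) (suc k)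
      (s≤s (+-monoˡ-≤ (suc k) (m∸n≤m n k))) ≤-refl)
  ... | no k≰n rewrite dec-false (suc k ≤? suc n) (k≰n ∘ s≤s⁻¹)
                     | partitions≤-⊖ (suc k) (s≤s (≰⇒> k≰n)) = refl

count-partitions≤-suc : ∀ b z k → count b (partitions≤ z (suc k))
  ≡ count b (partitions≤ z k) + count (b ∘ (suc k ∷_)) (partitions≤ (z ℤ.- + suc k) (suc k))
count-partitions≤-suc b z k = begin
  count b (partitions≤ z (suc k))
    ≡⟨ cong (count b) (partitions≤-suc z k) ⟩
  count b (partitions≤ z k ++ map (suc k ∷_) (partitions≤ (z ℤ.- + suc k) (suc k)))
    ≡⟨ count-++ b (partitions≤ z k) _ ⟩
  count b (partitions≤ z k) + count b (map (suc k ∷_) (partitions≤ (z ℤ.- + suc k) (suc k)))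
    ≡⟨ cong (λ n → count b (partitions≤ z k) + n) (count-map b (suc k ∷_) (partitions≤ (z ℤ.- + suc k) (suc k))) ⟩
  count b (partitions≤ z k) + count (b ∘ (suc k ∷_)) (partitions≤ (z ℤ.- + suc k) (suc k))
    ∎

length-partitions≤-suc : ∀ z k → length (partitions≤ z (suc k))
  ≡ length (partitions≤ z k) + length (partitions≤ (z ℤ.- + suc k) (suc k))
length-partitions≤-suc z k = begin
  length (partitions≤ z (suc k))
    ≡⟨ cong length (partitions≤-suc z k) ⟩
  length (partitions≤ z k ++ map (suc k ∷_) (partitions≤ (z ℤ.- + suc k) (suc k)))
    ≡⟨ length-++ (partitions≤ z k) ⟩
  length (partitions≤ z k) + length (map (suc k ∷_) (partitions≤ (z ℤ.- + suc k) (suc k)))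
    ≡⟨ cong (λ n → length (partitions≤ z k) + n) (length-map (suc k ∷_) (partitions≤ (z ℤ.- + suc k) (suc k))) ⟩
  length (partitions≤ z k) + length (partitions≤ (z ℤ.- + suc k) (suc k))
    ∎

partitions≤-suc-≥ : ∀ {z k} → z ℤ.≤ + k → partitions≤ z (suc k) ≡ partitions≤ z k
partitions≤-suc-≥ { -[1+ _ ]} _              = refl
partitions≤-suc-≥ {+ m} {k}  (ℤ.+≤+ m≤k) = begin
  partitions≤ (+ m) (suc k)
    ≡⟨ partitions≤-suc (+ m) k ⟩
  partitions≤ (+ m) k ++ map (suc k ∷_) (partitions≤ (m ⊖ suc k) (suc k))
    ≡⟨ cong (λ ps → partitions≤ (+ m) k ++ map (suc k ∷_) ps) (partitions≤-⊖ (suc k) (s≤s m≤k)) ⟩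
  partitions≤ (+ m) k ++ []
    ≡⟨ ++-identityʳ _ ⟩
  partitions≤ (+ m) k
    ∎

partitions≤-bound : ∀ {z k K} → z ℤ.≤ + k → k ≤ K → partitions≤ z K ≡ partitions≤ z k
partitions≤-bound {z} {k} z≤k k≤K = go (≤⇒≤′ k≤K)
  where
  go : ∀ {K} → k ≤′ K → partitions≤ z K ≡ partitions≤ z k
  go ≤′-refl        = refl
  go (≤′-step k≤′K) = trans (partitions≤-suc-≥ (ℤₚ.≤-trans z≤k (ℤ.+≤+ (≤′⇒≤ k≤′K)))) (go k≤′K)

pℤ≡length-partitions≤ : ∀ {z k} → z ℤ.≤ + k → pℤ z ≡ length (partitions≤ z k)
pℤ≡length-partitions≤ { -[1+ _ ]} _             = refl
pℤ≡length-partitions≤ {+ m}      (ℤ.+≤+ m≤k) = cong length (sym (partitions≤-bound ℤₚ.≤-refl m≤k))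

NonIncreasing≤ : ℕ → List ℕ → Set
NonIncreasing≤ b []       = ⊤
NonIncreasing≤ b (x ∷ xs) = x ≤ b × NonIncreasing≤ x xs

NonIncreasing≤-weaken : ∀ {b b′} xs → b ≤ b′ → NonIncreasing≤ b xs → NonIncreasing≤ b′ xs
NonIncreasing≤-weaken []       _    _          = tt
NonIncreasing≤-weaken (x ∷ xs) b≤b′ (x≤b , ni) = ≤-trans x≤b b≤b′ , ni

partitionsBounded-nonIncreasing : ∀ f n k → All (NonIncreasing≤ k) (partitionsBounded f n k)
partitionsBounded-nonIncreasing zero    _       _       = []
partitionsBounded-nonIncreasing (suc f) zero    _       = tt ∷ []
partitionsBounded-nonIncreasing (suc f) (suc n) zero    = []
partitionsBounded-nonIncreasing (suc f) (suc n) (suc k) = ++⁺ without-largest with-largest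
  where
  without-largest : All (NonIncreasing≤ (suc k)) (partitionsBounded f (suc n) k)
  without-largest = All.map (λ {xs} → NonIncreasing≤-weaken xs (n≤1+n k))
                            (partitionsBounded-nonIncreasing f (suc n) k)
  with-largest : All (NonIncreasing≤ (suc k))
    (if suc k ≤ᵇ suc n then map (suc k ∷_) (partitionsBounded f (n ∸ k) (suc k)) else [])
  with-largest with suc k ≤ᵇ suc n
  ... | true  = map⁺ (All.map (≤-refl ,_) (partitionsBounded-nonIncreasing f (n ∸ k) (suc k)))
  ... | false = []

partitionsBounded-length : ∀ f n k → All (λ xs → length xs ≤ n) (partitionsBounded f n k)
partitionsBounded-length zero    _       _       = []
partitionsBounded-length (suc f) zero    _       = z≤n ∷ []
partitionsBounded-length (suc f) (suc n) zero    = []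
partitionsBounded-length (suc f) (suc n) (suc k) = ++⁺ (partitionsBounded-length f (suc n) k) with-largest
  where
  with-largest : All (λ xs → length xs ≤ suc n)
    (if suc k ≤ᵇ suc n then map (suc k ∷_) (partitionsBounded f (n ∸ k) (suc k)) else [])
  with-largest with suc k ≤ᵇ suc n
  ... | true  = map⁺ (All.map (λ len≤ → s≤s (≤-trans len≤ (m∸n≤m n k)))
                              (partitionsBounded-length f (n ∸ k) (suc k)))
  ... | false = []

partitions≤-nonIncreasing : ∀ z k → All (NonIncreasing≤ k) (partitions≤ z k)
partitions≤-nonIncreasing (+ n)    k = partitionsBounded-nonIncreasing (suc (n + k)) n k
partitions≤-nonIncreasing -[1+ _ ] k = []

-- Partitions containing prescribed distinct parts

∧-elimˡ : ∀ {a b} → a ∧ b ≡ true → a ≡ true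
∧-elimˡ {true} _ = refl

∧-elimʳ : ∀ {a b} → a ∧ b ≡ true → b ≡ true
∧-elimʳ {true} b≡true = b≡true

containsAll : List ℕ → List ℕ → Bool
containsAll []      xs = true
containsAll (s ∷ S) xs = isPart s xs ∧ containsAll S xs

DistinctParts< : ℕ → List ℕ → Set
DistinctParts< c []      = ⊤
DistinctParts< c (s ∷ S) = 0 < s × s < c × DistinctParts< s S

DistinctParts<-weaken : ∀ {c c′} S → c ≤ c′ → DistinctParts< c S → DistinctParts< c′ S
DistinctParts<-weaken []      _    _                = tt
DistinctParts<-weaken (s ∷ S) c≤c′ (0<s , s<c , d) = 0<s , <-≤-trans s<c c≤c′ , d

isPart-∷-≢ : ∀ {x s} xs → x ≢ s → isPart s (x ∷ xs) ≡ isPart s xs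
isPart-∷-≢ {x} {s} xs x≢s = cong (_∨ isPart s xs) (dec-false (x ≟ s) x≢s)

isPart-∷-self : ∀ x xs → isPart x (x ∷ xs) ≡ true
isPart-∷-self x xs = cong (_∨ isPart x xs) (dec-true (x ≟ x) refl)

isPart-bounded : ∀ {b s} xs → NonIncreasing≤ b xs → isPart s xs ≡ true → s ≤ b
isPart-bounded {b} {s} (x ∷ xs) (x≤b , ni) s∈ with x ≟ s
... | yes refl = x≤b
... | no  x≢s  = ≤-trans (isPart-bounded xs ni (trans (sym (isPart-∷-≢ xs x≢s)) s∈)) x≤b

isPart-above : ∀ {b s} xs → NonIncreasing≤ b xs → b < s → isPart s xs ≡ false
isPart-above {b} {s} xs ni b<s with isPart s xs in s∈
... | false = refl
... | true  = ⊥-elim (<⇒≱ b<s (isPart-bounded xs ni s∈))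

containsAll-∷-above : ∀ {x} S xs → DistinctParts< x S → containsAll S (x ∷ xs) ≡ containsAll S xs
containsAll-∷-above []      xs _              = refl
containsAll-∷-above (s ∷ S) xs (_ , s<x , d) =
  cong₂ _∧_ (isPart-∷-≢ xs (λ x≡s → <-irrefl (sym x≡s) s<x))
            (containsAll-∷-above S xs (DistinctParts<-weaken S (<⇒≤ s<x) d))

x-y-z≡x-z-y : ∀ x y z → x ℤ.- y ℤ.- z ≡ x ℤ.- z ℤ.- y
x-y-z≡x-z-y = ℤ-Solver.solve-∀

x-y-z≡x-[y+z] : ∀ x y z → x ℤ.- y ℤ.- z ≡ x ℤ.- (y ℤ.+ z)
x-y-z≡x-[y+z] = ℤ-Solver.solve-∀

count-containsAll-largest : ∀ S k z → DistinctParts< (suc k) S →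
  count (containsAll (suc k ∷ S)) (partitions≤ z (suc k))
  ≡ count (containsAll S) (partitions≤ (z ℤ.- + suc k) (suc k))
count-containsAll-largest S k z d = begin
  count (containsAll (suc k ∷ S)) (partitions≤ z (suc k))
    ≡⟨ count-partitions≤-suc _ z k ⟩
  count (containsAll (suc k ∷ S)) (partitions≤ z k)
    + count (containsAll (suc k ∷ S) ∘ (suc k ∷_)) (partitions≤ (z ℤ.- + suc k) (suc k))
    ≡⟨ cong₂ _+_ (count-none (All.map lacks-largest (partitions≤-nonIncreasing z k)))
                 (count-cong has-largest (partitions≤ (z ℤ.- + suc k) (suc k))) ⟩
  count (containsAll S) (partitions≤ (z ℤ.- + suc k) (suc k))
    ∎
  where
  lacks-largest : ∀ {xs} → NonIncreasing≤ k xs → containsAll (suc k ∷ S) xs ≡ false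
  lacks-largest {xs} ni = cong (_∧ containsAll S xs) (isPart-above xs ni ≤-refl)
  has-largest : ∀ xs → containsAll (suc k ∷ S) (suc k ∷ xs) ≡ containsAll S xs
  has-largest xs = cong₂ _∧_ (isPart-∷-self (suc k) xs) (containsAll-∷-above S xs d)

count-containsAll-suc : ∀ S k z → DistinctParts< (suc k) S →
  count (containsAll S) (partitions≤ z (suc k))
  ≡ count (containsAll S) (partitions≤ z k) + count (containsAll S) (partitions≤ (z ℤ.- + suc k) (suc k))
count-containsAll-suc S k z d =
  trans (count-partitions≤-suc _ z k)
        (cong (λ n → count (containsAll S) (partitions≤ z k) + n)
              (count-cong (λ xs → containsAll-∷-above S xs d) (partitions≤ (z ℤ.- + suc k) (suc k))))

-- N bounds z only so that the recursion from z to z − (k + 1) visibly terminates.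
count-containsAll-< : ∀ N S k z → z ℤ.< + N → DistinctParts< (suc k) S →
  count (containsAll S) (partitions≤ z k) ≡ length (partitions≤ (z ℤ.- + sum S) k)
count-containsAll-< _ [] k z _ _ =
  trans (count-true (partitions≤ z k)) (cong (λ w → length (partitions≤ w k)) (sym (ℤₚ.+-identityʳ z)))
count-containsAll-< _    (zero ∷ _)  _       _        _          (() , _)
count-containsAll-< _    (suc _ ∷ _) zero    _        _          (_ , s≤s () , _)
count-containsAll-< _    (suc _ ∷ _) (suc _) -[1+ _ ] _          _ = refl
count-containsAll-< zero (suc _ ∷ _) (suc _) (+ _)    (ℤ.+<+ ()) _
count-containsAll-< N@(suc N′) S⁺@(suc s ∷ S) (suc k) (+ n) n<N@(ℤ.+<+ (s≤s n≤N′)) d@(_ , ss<ssk , dS)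
  with s ≟ k
... | yes refl = begin
  count (containsAll S⁺) (partitions≤ (+ n) (suc k))
    ≡⟨ count-containsAll-largest S k (+ n) dS ⟩
  count (containsAll S) (partitions≤ (+ n ℤ.- + suc k) (suc k))
    ≡⟨ count-containsAll-< N′ S (suc k) _ (ℤₚ.<-≤-trans (ℤₚ.m⊖1+n<m n (suc k)) (ℤ.+≤+ n≤N′))
                                          (DistinctParts<-weaken S (n≤1+n _) dS) ⟩
  length (partitions≤ (+ n ℤ.- + suc k ℤ.- + sum S) (suc k))
    ≡⟨ cong (λ w → length (partitions≤ w (suc k))) (x-y-z≡x-[y+z] (+ n) (+ suc k) (+ sum S)) ⟩
  length (partitions≤ (+ n ℤ.- (+ suc k ℤ.+ + sum S)) (suc k))
    ∎
... | no s≢k = begin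
  count (containsAll S⁺) (partitions≤ (+ n) (suc k))
    ≡⟨ count-containsAll-suc S⁺ k (+ n) dk ⟩
  count (containsAll S⁺) (partitions≤ (+ n) k)
    + count (containsAll S⁺) (partitions≤ (+ n ℤ.- + suc k) (suc k))
    ≡⟨ cong₂ _+_ (count-containsAll-< N S⁺ k (+ n) n<N dk)
                 (count-containsAll-< N′ S⁺ (suc k) _ (ℤₚ.<-≤-trans (ℤₚ.m⊖1+n<m n (suc k)) (ℤ.+≤+ n≤N′)) d) ⟩
  length (partitions≤ (+ n ℤ.- + σ) k) + length (partitions≤ (+ n ℤ.- + suc k ℤ.- + σ) (suc k))
    ≡⟨ cong (λ w → length (partitions≤ (+ n ℤ.- + σ) k) + length (partitions≤ w (suc k)))
            (x-y-z≡x-z-y (+ n) (+ suc k) (+ σ)) ⟩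
  length (partitions≤ (+ n ℤ.- + σ) k) + length (partitions≤ (+ n ℤ.- + σ ℤ.- + suc k) (suc k))
    ≡⟨ length-partitions≤-suc (+ n ℤ.- + σ) k ⟨
  length (partitions≤ (+ n ℤ.- + σ) (suc k))
    ∎
  where
  σ : ℕ
  σ = sum S⁺
  dk : DistinctParts< (suc k) S⁺
  dk = z<s , s≤s (≤∧≢⇒< (s≤s⁻¹ (s≤s⁻¹ ss<ssk)) s≢k) , dS

count-containsAll : ∀ S k z → DistinctParts< (suc k) S →
  count (containsAll S) (partitions≤ z k) ≡ length (partitions≤ (z ℤ.- + sum S) k)
count-containsAll S k z = count-containsAll-< (suc ℤ.∣ z ∣) S k z (z<1+∣z∣ z)
  where
  z<1+∣z∣ : ∀ z → z ℤ.< + suc ℤ.∣ z ∣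
  z<1+∣z∣ (+ n)    = ℤ.+<+ ≤-refl
  z<1+∣z∣ -[1+ _ ] = ℤ.-<+

count-containsAll-partitions : ∀ {c S} n → DistinctParts< c S →
  count (containsAll S) (partitions n) ≡ pℤ (+ n ℤ.- + sum S)
count-containsAll-partitions {c} {S} n d = begin
  count (containsAll S) (partitions≤ (+ n) n)
    ≡⟨ cong (count (containsAll S)) (partitions≤-bound ℤₚ.≤-refl (m≤m+n n c)) ⟨
  count (containsAll S) (partitions≤ (+ n) (n + c))
    ≡⟨ count-containsAll S (n + c) (+ n) (DistinctParts<-weaken S (≤-trans (m≤n+m c n) (n≤1+n _)) d) ⟩
  length (partitions≤ (+ n ℤ.- + sum S) (n + c))
    ≡⟨ pℤ≡length-partitions≤ n-σ≤n+c ⟨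
  pℤ (+ n ℤ.- + sum S)
    ∎
  where
  n-σ≤n+c : + n ℤ.- + sum S ℤ.≤ + (n + c)
  n-σ≤n+c = ℤₚ.≤-trans (ℤₚ.≤-reflexive (ℤₚ.m-n≡m⊖n n (sum S)))
              (ℤₚ.≤-trans (ℤₚ.m⊖n≤m n (sum S)) (ℤ.+≤+ (m≤m+n n c)))

-- The mex and arithmetic progressions of parts

progression : ℕ → ℕ → ℕ → List ℕ
progression m A zero    = []
progression m A (suc j) = m + j * A ∷ progression m A j

length-progression : ∀ m A j → length (progression m A j) ≡ j
length-progression m A zero    = refl
length-progression m A (suc j) = cong suc (length-progression m A j)

progression-distinct : ∀ {m A} j → 0 < m → 0 < A → DistinctParts< (m + j * A) (progression m A j)
progression-distinct zero    _   _   = tt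
progression-distinct {m} {A} (suc j) 0<m 0<A =
  ≤-trans 0<m (m≤m+n m (j * A)) ,
  +-monoʳ-< m (m<n+m (j * A) 0<A) ,
  progression-distinct j 0<m 0<A

containsAll-progression-true : ∀ {m A xs} j → (∀ i → i < j → isPart (m + i * A) xs ≡ true) →
  containsAll (progression m A j) xs ≡ true
containsAll-progression-true zero    _       = refl
containsAll-progression-true (suc j) present =
  cong₂ _∧_ (present j ≤-refl) (containsAll-progression-true j (λ i i<j → present i (m<n⇒m<1+n i<j)))

containsAll-progression-false : ∀ {m A xs k} j → k < j → isPart (m + k * A) xs ≡ false →
  containsAll (progression m A j) xs ≡ false
containsAll-progression-false {m} {A} {xs} {k} (suc j) k<1+j absent with k ≟ j
... | yes refl = cong (_∧ containsAll (progression m A j) xs) absent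
... | no  k≢j  = trans (cong (isPart (m + j * A) xs ∧_)
                             (containsAll-progression-false j (≤∧≢⇒< (s≤s⁻¹ k<1+j) k≢j) absent))
                       (∧-zeroʳ _)

containsAll-progression : ∀ {m A xs k} → (∀ i → i < k → isPart (m + i * A) xs ≡ true) →
  isPart (m + k * A) xs ≡ false → ∀ j → containsAll (progression m A j) xs ≡ (j ≤ᵇ k)
containsAll-progression {k = k} present absent j with j ≤? k
... | yes j≤k = trans (containsAll-progression-true j (λ i i<j → present i (<-≤-trans i<j j≤k)))
                      (sym (dec-true (j ≤? k) j≤k))
... | no  j≰k = trans (containsAll-progression-false j (≰⇒> j≰k) absent) (sym (dec-false (j ≤? k) j≰k))

length-≤-of-containsAll : ∀ {b c} S xs → NonIncreasing≤ b xs → DistinctParts< c S →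
  containsAll S xs ≡ true → length S ≤ length xs
length-≤-of-containsAll []      xs       _          _               _   = z≤n
length-≤-of-containsAll (s ∷ S) []       _          _               ()
length-≤-of-containsAll (s ∷ S) (x ∷ xs) (_ , ni) d@(0<s , _ , dS) all∈ with x ≟ s
... | yes refl = s≤s (length-≤-of-containsAll S xs ni dS
                        (trans (sym (containsAll-∷-above S xs dS)) (∧-elimʳ all∈)))
... | no  x≢s  = m≤n⇒m≤1+n (length-≤-of-containsAll (s ∷ S) xs ni (0<s , s<x , dS)
                              (trans (sym (containsAll-∷-above (s ∷ S) xs (0<s , s<x , dS))) all∈))
  where
  s∈xs : isPart s xs ≡ true
  s∈xs = trans (sym (isPart-∷-≢ xs x≢s)) (∧-elimˡ all∈)
  s<x : s < x
  s<x = ≤∧≢⇒< (isPart-bounded xs ni s∈xs) (x≢s ∘ sym)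

mexIndex : ℕ → ℕ → ℕ → List ℕ → ℕ
mexIndex zero    A m xs = 0
mexIndex (suc f) A m xs = if isPart m xs then suc (mexIndex f A (m + A) xs) else 0

mexSearch≡ : ∀ f A m xs → mexSearch f A m xs ≡ m + mexIndex f A m xs * A
mexSearch≡ zero    A m xs = sym (+-identityʳ m)
mexSearch≡ (suc f) A m xs with isPart m xs
... | true  = trans (mexSearch≡ f A (m + A) xs) (+-assoc m A _)
... | false = sym (+-identityʳ m)

mexIndex-isPart : ∀ f A m xs i → i < mexIndex f A m xs → isPart (m + i * A) xs ≡ true
mexIndex-isPart (suc f) A m xs i i<k with isPart m xs in m∈
mexIndex-isPart (suc f) A m xs zero    _         | true = trans (cong (λ x → isPart x xs) (+-identityʳ m)) m∈
mexIndex-isPart (suc f) A m xs (suc i) (s≤s i<k) | true =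
  trans (cong (λ x → isPart x xs) (sym (+-assoc m A (i * A)))) (mexIndex-isPart f A (m + A) xs i i<k)

mexIndex-notPart : ∀ f A m xs → mexIndex f A m xs < f → isPart (m + mexIndex f A m xs * A) xs ≡ false
mexIndex-notPart (suc f) A m xs k<f with isPart m xs in m∈
... | true  = trans (cong (λ x → isPart x xs) (sym (+-assoc m A _)))
                    (mexIndex-notPart f A (m + A) xs (s≤s⁻¹ k<f))
... | false = trans (cong (λ x → isPart x xs) (+-identityʳ m)) m∈

mexIndex-≤-length : ∀ {b} A m xs → 0 < m → 0 < A → NonIncreasing≤ b xs →
  mexIndex (suc (length xs)) A m xs ≤ length xs
mexIndex-≤-length A m xs 0<m 0<A ni =
  subst (_≤ length xs) (length-progression m A k)
    (length-≤-of-containsAll (progression m A k) xs ni (progression-distinct k 0<m 0<A)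
      (containsAll-progression-true k (mexIndex-isPart (suc (length xs)) A m xs)))
  where
  k : ℕ
  k = mexIndex (suc (length xs)) A m xs

-- Alternating sums

Σ₁-cong : ∀ {f g} N → (∀ r → f r ≡ g r) → Σ₁ N f ≡ Σ₁ N g
Σ₁-cong zero    e = refl
Σ₁-cong (suc N) e = cong₂ _+_ (Σ₁-cong N e) (e (suc N))

Σ₁-+ : ∀ N f g → Σ₁ N (λ r → f r + g r) ≡ Σ₁ N f + Σ₁ N g
Σ₁-+ zero    f g = refl
Σ₁-+ (suc N) f g = trans (cong (_+ (f (suc N) + g (suc N))) (Σ₁-+ N f g))
                         (+-+-comm (Σ₁ N f) (Σ₁ N g) (f (suc N)) _)
  where
  +-+-comm : ∀ a b c d → a + b + (c + d) ≡ a + c + (b + d)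
  +-+-comm = solve-∀

Σ₁-zero : ∀ N → Σ₁ N (λ _ → 0) ≡ 0
Σ₁-zero zero    = refl
Σ₁-zero (suc N) = cong (_+ 0) (Σ₁-zero N)

Σ₁-≤ᵇ : ∀ N q → Σ₁ N (λ r → 𝟙 (r ≤ᵇ q)) ≡ N ⊓ q
Σ₁-≤ᵇ zero    q = refl
Σ₁-≤ᵇ (suc N) q with suc N ≤? q
... | yes 1+N≤q = begin
  Σ₁ N (λ r → 𝟙 (r ≤ᵇ q)) + 𝟙 (suc N ≤ᵇ q) ≡⟨ cong₂ _+_ (Σ₁-≤ᵇ N q) (cong 𝟙 (dec-true (suc N ≤? q) 1+N≤q)) ⟩
  N ⊓ q + 1                                ≡⟨ cong (_+ 1) (m≤n⇒m⊓n≡m (<⇒≤ 1+N≤q)) ⟩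
  N + 1                                    ≡⟨ +-comm N 1 ⟩
  suc N                                    ≡⟨ m≤n⇒m⊓n≡m 1+N≤q ⟨
  suc N ⊓ q                                ∎
... | no  1+N≰q = begin
  Σ₁ N (λ r → 𝟙 (r ≤ᵇ q)) + 𝟙 (suc N ≤ᵇ q) ≡⟨ cong₂ _+_ (Σ₁-≤ᵇ N q) (cong 𝟙 (dec-false (suc N ≤? q) 1+N≰q)) ⟩
  N ⊓ q + 0                                ≡⟨ +-identityʳ _ ⟩
  N ⊓ q                                    ≡⟨ m≥n⇒m⊓n≡n (s≤s⁻¹ (≰⇒> 1+N≰q)) ⟩
  q                                        ≡⟨ m≥n⇒m⊓n≡n (<⇒≤ (≰⇒> 1+N≰q)) ⟨
  suc N ⊓ q                                ∎

Σ₁-≤ᵇ-reindex : ∀ {φ : ℕ → ℕ} {k q} N → (∀ r → φ r ≤ k ⇔ r ≤ q) → Σ₁ N (λ r → 𝟙 (φ r ≤ᵇ k)) ≡ N ⊓ q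
Σ₁-≤ᵇ-reindex {φ} {k} {q} N φ≤⇔ =
  trans (Σ₁-cong N (λ r → cong 𝟙 (does-⇔ (φ≤⇔ r) (φ r ≤? k) (r ≤? q)))) (Σ₁-≤ᵇ N q)

-- Σ_{j=0}^{2N} (-1)^j f j, grouped as in the theorem.
alternatingSum : ℕ → (ℕ → ℕ) → ℤ
alternatingSum N f = (+ f 0 ℤ.+ + Σ₁ N (λ r → f (2 * r))) ℤ.- + Σ₁ N (λ s → f (2 * s ∸ 1))

alternatingSum-cong : ∀ N f {a g h} → f 0 ≡ a → (∀ r → f (2 * r) ≡ g r) → (∀ s → f (2 * s ∸ 1) ≡ h s) →
  alternatingSum N f ≡ (+ a ℤ.+ + Σ₁ N g) ℤ.- + Σ₁ N h
alternatingSum-cong N f f0≡a even odd =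
  cong₂ ℤ._-_ (cong₂ ℤ._+_ (cong +_ f0≡a) (cong +_ (Σ₁-cong N even))) (cong +_ (Σ₁-cong N odd))

alternatingSum-≗ : ∀ N {f g} → (∀ j → f j ≡ g j) → alternatingSum N f ≡ alternatingSum N g
alternatingSum-≗ N {f} {g} f≗g =
  alternatingSum-cong N f {g 0} {g ∘ (2 *_)} {λ s → g (2 * s ∸ 1)}
                      (f≗g 0) (f≗g ∘ (2 *_)) (λ s → f≗g (2 * s ∸ 1))

alternatingSum-zero : ∀ N → alternatingSum N (λ _ → 0) ≡ + 0
alternatingSum-zero N rewrite Σ₁-zero N = refl

alternatingSum-+ : ∀ N f g → alternatingSum N (λ j → f j + g j) ≡ alternatingSum N f ℤ.+ alternatingSum N g
alternatingSum-+ N f g =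
  trans (cong₂ (λ x y → (+ (f 0 + g 0) ℤ.+ + x) ℤ.- + y) (Σ₁-+ N _ _) (Σ₁-+ N _ _))
        (regroup (+ f 0) (+ g 0) (+ Σ₁ N (λ r → f (2 * r))) (+ Σ₁ N (λ r → g (2 * r)))
                 (+ Σ₁ N (λ s → f (2 * s ∸ 1))) (+ Σ₁ N (λ s → g (2 * s ∸ 1))))
  where
  regroup : ∀ a b c d e f → (a ℤ.+ b ℤ.+ (c ℤ.+ d)) ℤ.- (e ℤ.+ f) ≡ (a ℤ.+ c ℤ.- e) ℤ.+ (b ℤ.+ d ℤ.- f)
  regroup = ℤ-Solver.solve-∀

count-alternatingSum : ∀ {A : Set} (b : A → Bool) (d : ℕ → A → Bool) N xs →
  All (λ x → + 𝟙 (b x) ≡ alternatingSum N (λ j → 𝟙 (d j x))) xs →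
  + count b xs ≡ alternatingSum N (λ j → count (d j) xs)
count-alternatingSum b d N []       []       = sym (alternatingSum-zero N)
count-alternatingSum b d N (x ∷ xs) (e ∷ es) = begin
  + count b (x ∷ xs)
    ≡⟨ cong +_ (count-∷ b x xs) ⟩
  + 𝟙 (b x) ℤ.+ + count b xs
    ≡⟨ cong₂ ℤ._+_ e (count-alternatingSum b d N xs es) ⟩
  alternatingSum N (λ j → 𝟙 (d j x)) ℤ.+ alternatingSum N (λ j → count (d j) xs)
    ≡⟨ alternatingSum-+ N (λ j → 𝟙 (d j x)) (λ j → count (d j) xs) ⟨
  alternatingSum N (λ j → 𝟙 (d j x) + count (d j) xs)
    ≡⟨ alternatingSum-≗ N (λ j → count-∷ (d j) x xs) ⟨
  alternatingSum N (λ j → count (d j) (x ∷ xs))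
    ∎

[2r≤2q]⇔[r≤q] : ∀ r q → 2 * r ≤ 2 * q ⇔ r ≤ q
[2r≤2q]⇔[r≤q] r q = mk⇔ (*-cancelˡ-≤ 2) (*-monoʳ-≤ 2)

[2r≤1+2q]⇔[r≤q] : ∀ r q → 2 * r ≤ suc (2 * q) ⇔ r ≤ q
[2r≤1+2q]⇔[r≤q] r q = mk⇔
  (λ 2r≤1+2q → s≤s⁻¹ (*-cancelˡ-< 2 r (suc q) (subst (2 * r <_) (sym (*-suc 2 q)) (s≤s 2r≤1+2q))))
  (λ r≤q → m≤n⇒m≤1+n (*-monoʳ-≤ 2 r≤q))

2[1+s]∸1≡1+2s : ∀ s → 2 * suc s ∸ 1 ≡ suc (2 * s)
2[1+s]∸1≡1+2s s = cong (_∸ 1) (*-suc 2 s)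

[2s∸1≤2q]⇔[s≤q] : ∀ s q → 2 * s ∸ 1 ≤ 2 * q ⇔ s ≤ q
[2s∸1≤2q]⇔[s≤q] zero    q = mk⇔ (λ _ → z≤n) (λ _ → z≤n)
[2s∸1≤2q]⇔[s≤q] (suc s) q = subst (λ x → x ≤ 2 * q ⇔ suc s ≤ q) (sym (2[1+s]∸1≡1+2s s)) (mk⇔
  (*-cancelˡ-< 2 s q)
  (λ 1+s≤q → ≤-trans (n≤1+n _) (subst (_≤ 2 * q) (*-suc 2 s) (*-monoʳ-≤ 2 1+s≤q))))

[2s∸1≤1+2q]⇔[s≤1+q] : ∀ s q → 2 * s ∸ 1 ≤ suc (2 * q) ⇔ s ≤ suc q
[2s∸1≤1+2q]⇔[s≤1+q] zero    q = mk⇔ (λ _ → z≤n) (λ _ → z≤n)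
[2s∸1≤1+2q]⇔[s≤1+q] (suc s) q = subst (λ x → x ≤ suc (2 * q) ⇔ suc s ≤ suc q) (sym (2[1+s]∸1≡1+2s s)) (mk⇔
  (s≤s ∘ *-cancelˡ-≤ 2 ∘ s≤s⁻¹)
  (s≤s ∘ *-monoʳ-≤ 2 ∘ s≤s⁻¹))

alternatingSum-≤ᵇ-even : ∀ N q → alternatingSum N (λ j → 𝟙 (j ≤ᵇ 2 * q)) ≡ + 1
alternatingSum-≤ᵇ-even N q =
  trans (cong₂ (λ x y → (+ 1 ℤ.+ + x) ℤ.- + y)
               (Σ₁-≤ᵇ-reindex N (λ r → [2r≤2q]⇔[r≤q] r q))
               (Σ₁-≤ᵇ-reindex N (λ s → [2s∸1≤2q]⇔[s≤q] s q)))
        (1+x-x≡1 (+ (N ⊓ q)))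
  where
  1+x-x≡1 : ∀ x → + 1 ℤ.+ x ℤ.- x ≡ + 1
  1+x-x≡1 = ℤ-Solver.solve-∀

alternatingSum-≤ᵇ-odd : ∀ {N q} → q < N → alternatingSum N (λ j → 𝟙 (j ≤ᵇ suc (2 * q))) ≡ + 0
alternatingSum-≤ᵇ-odd {N} {q} q<N =
  trans (cong₂ (λ x y → (+ 1 ℤ.+ + x) ℤ.- + y)
               (trans (Σ₁-≤ᵇ-reindex N (λ r → [2r≤1+2q]⇔[r≤q] r q)) (m≥n⇒m⊓n≡n (<⇒≤ q<N)))
               (trans (Σ₁-≤ᵇ-reindex N (λ s → [2s∸1≤1+2q]⇔[s≤1+q] s q)) (m≥n⇒m⊓n≡n q<N)))
        (ℤₚ.+-inverseʳ (+ suc q))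

evenOrOdd : ∀ k → ∃[ q ] (k ≡ 2 * q ⊎ k ≡ suc (2 * q))
evenOrOdd zero    = 0 , inj₁ refl
evenOrOdd (suc k) with evenOrOdd k
... | q , inj₁ refl = q , inj₂ refl
... | q , inj₂ refl = suc q , inj₁ (sym (*-suc 2 q))

[a+2qA]%2A≡a%2A : ∀ a q B → (a + 2 * q * suc B) % (2 * suc B) ≡ a % (2 * suc B)
[a+2qA]%2A≡a%2A a q B =
  trans (cong (λ x → (a + x) % (2 * suc B)) (trans (cong (_* suc B) (*-comm 2 q)) (*-assoc q 2 (suc B))))
        ([m+kn]%n≡m%n a q (2 * suc B))

[a+[1+2q]A]%2A≢a%2A : ∀ a q B → 0 < a → a ≤ suc B →
  (a + suc (2 * q) * suc B) % (2 * suc B) ≢ a % (2 * suc B)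
[a+[1+2q]A]%2A≢a%2A a q B 0<a a≤A eq = impossible (m≤n⇒m<n∨m≡n a≤A)
  where
  A : ℕ
  A = suc B
  A+A≡2A : A + A ≡ 2 * A
  A+A≡2A = cong (λ x → A + x) (sym (+-identityʳ A))
  regroup : ∀ a q A → a + A + q * (2 * A) ≡ a + suc (2 * q) * A
  regroup = solve-∀
  [a+A]%2A≡a : (a + A) % (2 * A) ≡ a
  [a+A]%2A≡a = begin
    (a + A) % (2 * A)                ≡⟨ [m+kn]%n≡m%n (a + A) q (2 * A) ⟨
    (a + A + q * (2 * A)) % (2 * A)  ≡⟨ cong (_% (2 * A)) (regroup a q A) ⟩
    (a + suc (2 * q) * A) % (2 * A)  ≡⟨ eq ⟩
    a % (2 * A)                      ≡⟨ m<n⇒m%n≡m (≤-<-trans a≤A (m<m+n A z<s)) ⟩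
    a                                ∎
  impossible : a < A ⊎ a ≡ A → ⊥
  impossible (inj₁ a<A) = 1+n≢0 (+-cancelˡ-≡ a A 0 (trans a+A≡a (sym (+-identityʳ a))))
    where
    a+A≡a : a + A ≡ a
    a+A≡a = trans (sym (m<n⇒m%n≡m (subst (a + A <_) A+A≡2A (+-monoˡ-< A a<A)))) [a+A]%2A≡a
  impossible (inj₂ a≡A) = <⇒≢ 0<a (begin
    0                  ≡⟨ n%n≡0 (2 * A) ⟨
    (2 * A) % (2 * A)  ≡⟨ cong (_% (2 * A)) A+A≡2A ⟨
    (A + A) % (2 * A)  ≡⟨ cong (λ x → (x + A) % (2 * A)) a≡A ⟨
    (a + A) % (2 * A)  ≡⟨ [a+A]%2A≡a ⟩
    a                  ∎)

𝟙-parity≡alternatingSum : ∀ {a B k N} → 0 < a → a ≤ suc B → k ≤ N →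
  + 𝟙 ((a + k * suc B) % (2 * suc B) ≡ᵇ a % (2 * suc B)) ≡ alternatingSum N (λ j → 𝟙 (j ≤ᵇ k))
𝟙-parity≡alternatingSum {a} {B} {k} {N} 0<a a≤A k≤N with evenOrOdd k
... | q , inj₁ refl =
  trans (cong (+_ ∘ 𝟙) (dec-true ((a + 2 * q * suc B) % (2 * suc B) ≟ a % (2 * suc B)) ([a+2qA]%2A≡a%2A a q B)))
        (sym (alternatingSum-≤ᵇ-even N q))
... | q , inj₂ refl =
  trans (cong (+_ ∘ 𝟙) (dec-false ((a + suc (2 * q) * suc B) % (2 * suc B) ≟ a % (2 * suc B))
                                 ([a+[1+2q]A]%2A≢a%2A a q B 0<a a≤A)))
        (sym (alternatingSum-≤ᵇ-odd (≤-trans (s≤s (m≤n*m q 2)) k≤N)))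

𝟙-mex≡alternatingSum : ∀ {B a b N} xs → 0 < a → a ≤ suc B → NonIncreasing≤ b xs → length xs ≤ N →
  + 𝟙 (mex (suc B) a xs % (2 * suc B) ≡ᵇ a % (2 * suc B))
  ≡ alternatingSum N (λ j → 𝟙 (containsAll (progression a (suc B) j) xs))
𝟙-mex≡alternatingSum {B} {a@(suc _)} {N = N} xs 0<a a≤A ni len≤N = begin
  + 𝟙 (mex A a xs % (2 * A) ≡ᵇ a % (2 * A))
    ≡⟨ cong (λ x → + 𝟙 (x % (2 * A) ≡ᵇ a % (2 * A))) mex≡a+kA ⟩
  + 𝟙 ((a + k * A) % (2 * A) ≡ᵇ a % (2 * A))
    ≡⟨ 𝟙-parity≡alternatingSum 0<a a≤A (≤-trans k≤length len≤N) ⟩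
  alternatingSum N (λ j → 𝟙 (j ≤ᵇ k))
    ≡⟨ alternatingSum-≗ N (λ j → cong 𝟙 (sym (containsAll-progression {a} {A} {xs} present absent j))) ⟩
  alternatingSum N (λ j → 𝟙 (containsAll (progression a A j) xs))
    ∎
  where
  A : ℕ
  A = suc B
  f : ℕ
  f = suc (length xs)
  k : ℕ
  k = mexIndex f A a xs
  k≤length : k ≤ length xs
  k≤length = mexIndex-≤-length A a xs 0<a z<s ni
  mex≡a+kA : mex A a xs ≡ a + k * A
  mex≡a+kA = trans (cong (λ m → mexSearch f A (suc m) xs) (m<n⇒m%n≡m a≤A)) (mexSearch≡ f A a xs)
  present : ∀ i → i < k → isPart (a + i * A) xs ≡ true
  present = mexIndex-isPart f A a xs
  absent : isPart (a + k * A) xs ≡ false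
  absent = mexIndex-notPart f A a xs (s≤s k≤length)

pA-alternatingSum : ∀ A a n → 0 < a → a ≤ A →
  + pA A a n ≡ alternatingSum n (λ j → pℤ (+ n ℤ.- + sum (progression a A j)))
pA-alternatingSum zero    (suc _) _ _   ()
pA-alternatingSum (suc B) a       n 0<a a≤A = begin
  + pA (suc B) a n
    ≡⟨ count-alternatingSum mexCondition (λ j → containsAll (progression a (suc B) j)) n (partitions n)
         (All.zipWith (λ {xs} (ni , len≤n) → 𝟙-mex≡alternatingSum xs 0<a a≤A ni len≤n)
                      (partitions≤-nonIncreasing (+ n) n , partitionsBounded-length (suc (n + n)) n n)) ⟩
  alternatingSum n (λ j → count (containsAll (progression a (suc B) j)) (partitions n))
    ≡⟨ alternatingSum-≗ n (λ j → count-containsAll-partitions {S = progression a (suc B) j} n (progression-distinct j 0<a z<s)) ⟩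
  alternatingSum n (λ j → pℤ (+ n ℤ.- + sum (progression a (suc B) j)))
    ∎
  where
  mexCondition : List ℕ → Bool
  mexCondition xs = mex (suc B) a xs % (2 * suc B) ≡ᵇ a % (2 * suc B)

-- Sums of the progressions

sum-progression : ∀ m A j → sum (progression m A j) * 2 + j * A ≡ j * (2 * m + j * A)
sum-progression m A zero    = refl
sum-progression m A (suc j) = begin
  (m + j * A + σ) * 2 + suc j * A               ≡⟨ shift m A j σ ⟩
  σ * 2 + j * A + (2 * m + 2 * (j * A) + A)     ≡⟨ cong (_+ (2 * m + 2 * (j * A) + A)) (sum-progression m A j) ⟩
  j * (2 * m + j * A) + (2 * m + 2 * (j * A) + A) ≡⟨ expand m A j ⟩
  suc j * (2 * m + suc j * A)                   ∎
  where
  σ : ℕ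
  σ = sum (progression m A j)
  shift : ∀ m A j σ → (m + j * A + σ) * 2 + suc j * A ≡ σ * 2 + j * A + (2 * m + 2 * (j * A) + A)
  shift = solve-∀
  expand : ∀ m A j → j * (2 * m + j * A) + (2 * m + 2 * (j * A) + A) ≡ suc j * (2 * m + suc j * A)
  expand = solve-∀

sum-progression-triangular : ∀ t j → sum (progression t t j) * 2 ≡ t * (j * suc j)
sum-progression-triangular t j = +-cancelʳ-≡ (j * t) _ _ (trans (sum-progression t t j) (expand t j))
  where
  expand : ∀ t j → j * (2 * t + j * t) ≡ t * (j * suc j) + j * t
  expand = solve-∀

sum-progression-square : ∀ t j → sum (progression t (2 * t) j) ≡ t * (j * j)
sum-progression-square t j =
  *-cancelʳ-≡ _ _ 2 (+-cancelʳ-≡ (j * (2 * t)) _ _ (trans (sum-progression t (2 * t) j) (expand t j)))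
  where
  expand : ∀ t j → j * (2 * t + j * (2 * t)) ≡ t * (j * j) * 2 + j * (2 * t)
  expand = solve-∀

sum-progression-even : ∀ t r → sum (progression t t (2 * r)) ≡ t * (r * (2 * r + 1))
sum-progression-even t r = *-cancelʳ-≡ _ _ 2 (trans (sum-progression-triangular t (2 * r)) (regroup t r))
  where
  regroup : ∀ t r → t * (2 * r * suc (2 * r)) ≡ t * (r * (2 * r + 1)) * 2
  regroup = solve-∀

sum-progression-odd : ∀ t s → sum (progression t t (2 * s ∸ 1)) ≡ t * (s * (2 * s ∸ 1))
sum-progression-odd t zero    = sym (*-zeroʳ t)
sum-progression-odd t (suc s) = begin
  sum (progression t t (2 * suc s ∸ 1)) ≡⟨ cong (sum ∘ progression t t) (2[1+s]∸1≡1+2s s) ⟩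
  sum (progression t t (suc (2 * s)))   ≡⟨ *-cancelʳ-≡ _ _ 2 (trans (sum-progression-triangular t (suc (2 * s))) (regroup t s)) ⟩
  t * (suc s * suc (2 * s))             ≡⟨ cong (λ j → t * (suc s * j)) (2[1+s]∸1≡1+2s s) ⟨
  t * (suc s * (2 * suc s ∸ 1))         ∎
  where
  regroup : ∀ t s → t * (suc (2 * s) * suc (suc (2 * s))) ≡ t * (suc s * suc (2 * s)) * 2
  regroup = solve-∀

sum-progression-square-even : ∀ t r → sum (progression t (2 * t) (2 * r)) ≡ 4 * t * (r * r)
sum-progression-square-even t r = trans (sum-progression-square t (2 * r)) (regroup t r)
  where
  regroup : ∀ t r → t * (2 * r * (2 * r)) ≡ 4 * t * (r * r)
  regroup = solve-∀

theorem2p1 : (t : ℕ) → 0 < t → (n : ℕ) →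
    (+ pA t t n
       ≡ (+ p n ℤ.+ + Σ₁ n (λ r → pℤ (+ n ℤ.- + (t * (r * (2 * r + 1))))))
         ℤ.- + Σ₁ n (λ s → pℤ (+ n ℤ.- + (t * (s * (2 * s ∸ 1))))))
    × (+ pA (2 * t) t n
       ≡ (+ p n ℤ.+ + Σ₁ n (λ r → pℤ (+ n ℤ.- + (4 * t * (r * r)))))
         ℤ.- + Σ₁ n (λ s → pℤ (+ n ℤ.- + (t * ((2 * s ∸ 1) * (2 * s ∸ 1))))))
theorem2p1 t 0<t n =
    trans (pA-alternatingSum t t n 0<t ≤-refl)
          (alternatingSum-cong n (pℤ[n-_] ∘ sum ∘ progression t t) p-n
                                   (cong pℤ[n-_] ∘ sum-progression-even t)
                                   (cong pℤ[n-_] ∘ sum-progression-odd t))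
  , trans (pA-alternatingSum (2 * t) t n 0<t (m≤n*m t 2))
          (alternatingSum-cong n (pℤ[n-_] ∘ sum ∘ progression t (2 * t)) p-n
                                   (cong pℤ[n-_] ∘ sum-progression-square-even t)
                                   (cong pℤ[n-_] ∘ sum-progression-square t ∘ (λ s → 2 * s ∸ 1)))
  where
  pℤ[n-_] : ℕ → ℕ
  pℤ[n- σ ] = pℤ (+ n ℤ.- + σ)
  p-n : pℤ[n- 0 ] ≡ p n
  p-n = cong pℤ (ℤₚ.+-identityʳ (+ n))
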